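{- Let $\mathcal R$ be a model of $\operatorname{\mathbf{MELL}}$ and let $v$ be a valuation in $\mathcal R$. Let $\varphi$ be a formula of $\operatorname{\mathbf{MELL}}$ with interpretation $|\varphi|^X_Y$ in $\mathfrak D (\mathcal R)$, where the interpretation of an atomic proposition $p$ is the family over $X = Y = \{*\}$ given by $\binom{*}{*} \mapsto v(p)$. Then the types \[ \sum_{x : X} \prod_{y : Y} \hom_R (\llbracket \varphi \rrbracket, |\varphi|^x_y) \] and \[ \sum_{y : Y} \prod_{x : X} \hom_R (|\varphi|^x_y, \llbracket \varphi \rrbracket) \] are inhabited.
   Context: $\mathcal R$ is a linear-nonlinear adjunction $L \dashv M : R \to S$ with $! = L \circ M$; a valuation maps atoms to objects of $R$ and $\llbracket \varphi \rrbracket$ is the induced interpretation in $R$. $\mathfrak D(\mathcal R)$ interprets formulas in $\mathfrak D_l(R)$ (objects: families $\mathcal G^X_Y$ of objects of $R$ indexed by witnesses $x \in X$ and counter-witnesses $y \in Y$), with $|\varphi|^x_y$ denoting the component at $(x,y)$. Connectives: $(\mathcal G^X_Y)^\bot : \binom{y}{x} \mapsto (\mathcal G^x_y)^\bot$; $\mathcal G \otimes \mathcal H : \binom{x,u}{f,g} \mapsto \mathcal G^x_{fu} \otimes \mathcal H^u_{gx}$ ($f : U \to Y$, $g : X \to V$); $\mathcal G ⅋ \mathcal H : \binom{f,g}{y,v} \mapsto \mathcal G^{fv}_y ⅋ \mathcal H^{gy}_v$ (par, $f : V \to X$, $g : Y \to U$); $!\mathcal G$: witnesses $X$, counter-witnesses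 $X \to Y^*$ ($Y^*$ finite multisets), $\binom{x}{f} \mapsto \bigotimes_{y \in fx} !\mathcal G^x_y$; $?\mathcal G$: witnesses $Y \to X^*$, counter-witnesses $Y$, $\binom{g}{y} \mapsto ⅋_{x \in gy}\, ?\mathcal G^x_y$ (iterated par). -}

module Defs where

open import Level using (Level; _⊔_) renaming (suc to lsuc)
open import Relation.Binary using (IsEquivalence)
open import Data.Product using (Σ; _×_; _,_)
open import Data.Unit using (⊤; tt)
open import Data.List using (List; []; _∷_; map)

private
  variable
    o ℓ e o′ ℓ′ e′ : Level

record Category (o ℓ e : Level) : Set (lsuc (o ⊔ ℓ ⊔ e)) where
  infix  4 _≈_ _⇒_ _≅_
  infixr 9 _∘_
  field
    Obj       : Set o
    _⇒_       : Obj → Obj → Set ℓ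
    _≈_       : ∀ {A B} → A ⇒ B → A ⇒ B → Set e
    id        : ∀ {A} → A ⇒ A
    _∘_       : ∀ {A B C} → B ⇒ C → A ⇒ B → A ⇒ C
    equiv     : ∀ {A B} → IsEquivalence (_≈_ {A} {B})
    ∘-resp-≈  : ∀ {A B C} {f h : B ⇒ C} {g i : A ⇒ B} →
                f ≈ h → g ≈ i → f ∘ g ≈ h ∘ i
    assoc     : ∀ {A B C D} {f : A ⇒ B} {g : B ⇒ C} {h : C ⇒ D} →
                (h ∘ g) ∘ f ≈ h ∘ (g ∘ f)
    identityˡ : ∀ {A B} {f : A ⇒ B} → id ∘ f ≈ f
    identityʳ : ∀ {A B} {f : A ⇒ B} → f ∘ id ≈ f

  record _≅_ (A B : Obj) : Set (ℓ ⊔ e) where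
    field
      from  : A ⇒ B
      to    : B ⇒ A
      isoˡ  : to ∘ from ≈ id
      isoʳ  : from ∘ to ≈ id

record Functor (C : Category o ℓ e) (D : Category o′ ℓ′ e′)
       : Set (o ⊔ ℓ ⊔ e ⊔ o′ ⊔ ℓ′ ⊔ e′) where
  private
    module C = Category C
    module D = Category D
  field
    F₀           : C.Obj → D.Obj
    F₁           : ∀ {A B} → A C.⇒ B → F₀ A D.⇒ F₀ B
    identity     : ∀ {A} → F₁ (C.id {A}) D.≈ D.id
    homomorphism : ∀ {A B E} {f : A C.⇒ B} {g : B C.⇒ E} →
                   F₁ (g C.∘ f) D.≈ F₁ g D.∘ F₁ f
    F-resp-≈     : ∀ {A B} {f g : A C.⇒ B} → f C.≈ g → F₁ f D.≈ F₁ g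

record SymmetricMonoidal (C : Category o ℓ e) : Set (o ⊔ ℓ ⊔ e) where
  open Category C
  open _≅_
  infixr 10 _⊗₀_ _⊗₁_
  field
    _⊗₀_ : Obj → Obj → Obj
    _⊗₁_ : ∀ {A B X Y} → A ⇒ B → X ⇒ Y → A ⊗₀ X ⇒ B ⊗₀ Y
    unit : Obj
    ⊗-identity     : ∀ {A B} → id {A} ⊗₁ id {B} ≈ id
    ⊗-homomorphism : ∀ {A B E X Y Z} {f : A ⇒ B} {g : B ⇒ E}
                       {h : X ⇒ Y} {i : Y ⇒ Z} →
                     (g ∘ f) ⊗₁ (i ∘ h) ≈ (g ⊗₁ i) ∘ (f ⊗₁ h)
    ⊗-resp-≈       : ∀ {A B X Y} {f g : A ⇒ B} {h i : X ⇒ Y} →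
                     f ≈ g → h ≈ i → f ⊗₁ h ≈ g ⊗₁ i
    unitorˡ    : ∀ {A} → unit ⊗₀ A ≅ A
    unitorʳ    : ∀ {A} → A ⊗₀ unit ≅ A
    associator : ∀ {A B E} → (A ⊗₀ B) ⊗₀ E ≅ A ⊗₀ (B ⊗₀ E)
    braiding   : ∀ {A B} → A ⊗₀ B ≅ B ⊗₀ A
    unitorˡ-natural    : ∀ {A B} {f : A ⇒ B} →
                         from unitorˡ ∘ (id ⊗₁ f) ≈ f ∘ from unitorˡ
    unitorʳ-natural    : ∀ {A B} {f : A ⇒ B} →
                         from unitorʳ ∘ (f ⊗₁ id) ≈ f ∘ from unitorʳ
    associator-natural : ∀ {A B X Y U V} {f : A ⇒ B} {g : X ⇒ Y} {h : U ⇒ V} →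
                         from associator ∘ ((f ⊗₁ g) ⊗₁ h)
                           ≈ (f ⊗₁ (g ⊗₁ h)) ∘ from associator
    braiding-natural   : ∀ {A B X Y} {f : A ⇒ B} {g : X ⇒ Y} →
                         from braiding ∘ (f ⊗₁ g) ≈ (g ⊗₁ f) ∘ from braiding
    triangle   : ∀ {A B} →
                 (id {A} ⊗₁ from (unitorˡ {B})) ∘ from associator
                   ≈ from unitorʳ ⊗₁ id
    pentagon   : ∀ {A B E F} →
                 (id {A} ⊗₁ from (associator {B} {E} {F})) ∘
                   (from associator ∘ (from associator ⊗₁ id))
                   ≈ from associator ∘ from associator
    hexagon    : ∀ {A B E} →
                 (id {B} ⊗₁ from (braiding {A} {E})) ∘
                   (from associator ∘ (from braiding ⊗₁ id))
                   ≈ from associator ∘ (from braiding ∘ from associator)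
    commutative : ∀ {A B} → from (braiding {B} {A}) ∘ from braiding ≈ id

record StarAutonomous {C : Category o ℓ e} (M : SymmetricMonoidal C)
       : Set (o ⊔ ℓ ⊔ e) where
  open Category C
  open SymmetricMonoidal M
  open _≅_
  field
    neg₀ : Obj → Obj
    neg₁ : ∀ {A B} → A ⇒ B → neg₀ B ⇒ neg₀ A
    neg-identity     : ∀ {A} → neg₁ (id {A}) ≈ id
    neg-homomorphism : ∀ {A B E} {f : A ⇒ B} {g : B ⇒ E} →
                       neg₁ (g ∘ f) ≈ neg₁ f ∘ neg₁ g
    neg-resp-≈       : ∀ {A B} {f g : A ⇒ B} → f ≈ g → neg₁ f ≈ neg₁ g
    doubleNeg         : ∀ {A} → A ≅ neg₀ (neg₀ A)
    doubleNeg-natural : ∀ {A B} {f : A ⇒ B} →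
                        from doubleNeg ∘ f ≈ neg₁ (neg₁ f) ∘ from doubleNeg
    curry   : ∀ {A B E} → A ⊗₀ B ⇒ neg₀ E → A ⇒ neg₀ (B ⊗₀ E)
    uncurry : ∀ {A B E} → A ⇒ neg₀ (B ⊗₀ E) → A ⊗₀ B ⇒ neg₀ E
    curry-resp-≈   : ∀ {A B E} {f g : A ⊗₀ B ⇒ neg₀ E} →
                     f ≈ g → curry f ≈ curry g
    uncurry-resp-≈ : ∀ {A B E} {f g : A ⇒ neg₀ (B ⊗₀ E)} →
                     f ≈ g → uncurry f ≈ uncurry g
    uncurry-curry  : ∀ {A B E} {f : A ⊗₀ B ⇒ neg₀ E} → uncurry (curry f) ≈ f
    curry-uncurry  : ∀ {A B E} {f : A ⇒ neg₀ (B ⊗₀ E)} → curry (uncurry f) ≈ f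
    curry-naturalˡ : ∀ {A A′ B E} {f : A ⊗₀ B ⇒ neg₀ E} {g : A′ ⇒ A} →
                     curry (f ∘ (g ⊗₁ id)) ≈ curry f ∘ g
    curry-naturalʳ : ∀ {A B B′ E E′} {f : A ⊗₀ B ⇒ neg₀ E}
                       {g : B′ ⇒ B} {h : E′ ⇒ E} →
                     curry (neg₁ h ∘ (f ∘ (id ⊗₁ g)))
                       ≈ neg₁ (g ⊗₁ h) ∘ curry f

record Cartesian (C : Category o ℓ e) : Set (o ⊔ ℓ ⊔ e) where
  open Category C
  infixr 7 _×₀_
  field
    ⊤₀  : Obj
    !   : ∀ {A} → A ⇒ ⊤₀
    !-unique : ∀ {A} (f : A ⇒ ⊤₀) → ! ≈ f
    _×₀_ : Obj → Obj → Obj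
    π₁  : ∀ {A B} → A ×₀ B ⇒ A
    π₂  : ∀ {A B} → A ×₀ B ⇒ B
    ⟨_,_⟩ : ∀ {A B E} → E ⇒ A → E ⇒ B → E ⇒ A ×₀ B
    project₁ : ∀ {A B E} {f : E ⇒ A} {g : E ⇒ B} → π₁ ∘ ⟨ f , g ⟩ ≈ f
    project₂ : ∀ {A B E} {f : E ⇒ A} {g : E ⇒ B} → π₂ ∘ ⟨ f , g ⟩ ≈ g
    unique   : ∀ {A B E} {h : E ⇒ A ×₀ B} {f : E ⇒ A} {g : E ⇒ B} →
               π₁ ∘ h ≈ f → π₂ ∘ h ≈ g → ⟨ f , g ⟩ ≈ h

  _⁂_ : ∀ {A B X Y} → A ⇒ B → X ⇒ Y → A ×₀ X ⇒ B ×₀ Y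
  f ⁂ g = ⟨ f ∘ π₁ , g ∘ π₂ ⟩

  assocˣ : ∀ {A B E} → (A ×₀ B) ×₀ E ⇒ A ×₀ (B ×₀ E)
  assocˣ = ⟨ π₁ ∘ π₁ , ⟨ π₂ ∘ π₁ , π₂ ⟩ ⟩

  swapˣ : ∀ {A B} → A ×₀ B ⇒ B ×₀ A
  swapˣ = ⟨ π₂ , π₁ ⟩

-- Models of MELL: linear-nonlinear adjunctions (Benton)
--   L ⊣ M, L : S → R strong symmetric monoidal, S cartesian,
--   R symmetric monoidal (here *-autonomous, for the classical
--   connectives ⊥, ⅋, ?), and ! = L ∘ M.

record MELLModel (o ℓ e : Level) : Set (lsuc (o ⊔ ℓ ⊔ e)) where
  field
    R : Category o ℓ e
    S : Category o ℓ e
    monoidal  : SymmetricMonoidal R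
    starAut   : StarAutonomous monoidal
    cartesian : Cartesian S
    L : Functor S R
    M : Functor R S

  private
    module R = Category R
    module S = Category S
    module Lf = Functor L
    module Mf = Functor M
  open SymmetricMonoidal monoidal
  open Cartesian cartesian
  open R._≅_

  field
    η : ∀ {X} → X S.⇒ Mf.F₀ (Lf.F₀ X)
    ε : ∀ {A} → Lf.F₀ (Mf.F₀ A) R.⇒ A
    η-natural : ∀ {X Y} {f : X S.⇒ Y} →
                η S.∘ f S.≈ Mf.F₁ (Lf.F₁ f) S.∘ η
    ε-natural : ∀ {A B} {f : A R.⇒ B} →
                ε R.∘ Lf.F₁ (Mf.F₁ f) R.≈ f R.∘ ε
    zig : ∀ {X} → ε R.∘ Lf.F₁ (η {X}) R.≈ R.id
    zag : ∀ {A} → Mf.F₁ (ε {A}) S.∘ η S.≈ S.id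
    L-unit : unit R.≅ Lf.F₀ ⊤₀
    L-μ    : ∀ {X Y} → Lf.F₀ X ⊗₀ Lf.F₀ Y R.≅ Lf.F₀ (X ×₀ Y)
    L-μ-natural : ∀ {X X′ Y Y′} {f : X S.⇒ X′} {g : Y S.⇒ Y′} →
                  from L-μ R.∘ (Lf.F₁ f ⊗₁ Lf.F₁ g)
                    R.≈ Lf.F₁ (f ⁂ g) R.∘ from L-μ
    L-associative : ∀ {X Y Z} →
                    Lf.F₁ (assocˣ {X} {Y} {Z}) R.∘
                      (from L-μ R.∘ (from L-μ ⊗₁ R.id))
                      R.≈ from L-μ R.∘
                            ((R.id ⊗₁ from L-μ) R.∘ from associator)
    L-unitaryˡ : ∀ {X} →
                 Lf.F₁ (π₂ {⊤₀} {X}) R.∘ (from L-μ R.∘ (from L-unit ⊗₁ R.id))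
                   R.≈ from unitorˡ
    L-unitaryʳ : ∀ {X} →
                 Lf.F₁ (π₁ {X} {⊤₀}) R.∘ (from L-μ R.∘ (R.id ⊗₁ from L-unit))
                   R.≈ from unitorʳ
    L-braiding : ∀ {X Y} →
                 Lf.F₁ (swapˣ {X} {Y}) R.∘ from L-μ
                   R.≈ from L-μ R.∘ from braiding

  open StarAutonomous starAut using (neg₀)

  Ob : Set o
  Ob = R.Obj

  Hom : Ob → Ob → Set ℓ
  Hom = R._⇒_

  _⊗_ : Ob → Ob → Ob
  A ⊗ B = A ⊗₀ B

  _ᗮ : Ob → Ob
  A ᗮ = neg₀ A

  _⅋_ : Ob → Ob → Ob
  A ⅋ B = neg₀ (neg₀ A ⊗₀ neg₀ B)

  I : Ob
  I = unit

  ⊥₀ : Ob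
  ⊥₀ = neg₀ unit

  !₀ : Ob → Ob
  !₀ A = Lf.F₀ (Mf.F₀ A)

  ?₀ : Ob → Ob
  ?₀ A = neg₀ (!₀ (neg₀ A))

  ⨂ : List Ob → Ob
  ⨂ []       = I
  ⨂ (A ∷ As) = A ⊗ ⨂ As

  ⅋⨂ : List Ob → Ob
  ⅋⨂ []       = ⊥₀
  ⅋⨂ (A ∷ As) = A ⅋ ⅋⨂ As

infixr 6 _⊗ᶠ_ _⅋ᶠ_
data Formula (Atom : Set) : Set where
  atom  : Atom → Formula Atom
  _ᗮᶠ   : Formula Atom → Formula Atom
  _⊗ᶠ_  : Formula Atom → Formula Atom → Formula Atom
  _⅋ᶠ_  : Formula Atom → Formula Atom → Formula Atom
  !ᶠ    : Formula Atom → Formula Atom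
  ?ᶠ    : Formula Atom → Formula Atom

module Interpretation {o ℓ e : Level} (𝓡 : MELLModel o ℓ e)
                      {Atom : Set} (v : Atom → MELLModel.Ob 𝓡) where
  open MELLModel 𝓡

  ⟦_⟧ : Formula Atom → Ob
  ⟦ atom p ⟧  = v p
  ⟦ φ ᗮᶠ ⟧    = ⟦ φ ⟧ ᗮ
  ⟦ φ ⊗ᶠ ψ ⟧  = ⟦ φ ⟧ ⊗ ⟦ ψ ⟧
  ⟦ φ ⅋ᶠ ψ ⟧  = ⟦ φ ⟧ ⅋ ⟦ ψ ⟧
  ⟦ !ᶠ φ ⟧    = !₀ ⟦ φ ⟧
  ⟦ ?ᶠ φ ⟧    = ?₀ ⟦ φ ⟧

  -- Dialectica interpretation in 𝔇_l(R): witnesses Wit φ (= X),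
  -- counter-witnesses CoWit φ (= Y); finite multisets Y* are represented
  -- by lists.
  Wit   : Formula Atom → Set
  CoWit : Formula Atom → Set
  Wit (atom p)   = ⊤
  Wit (φ ᗮᶠ)     = CoWit φ
  Wit (φ ⊗ᶠ ψ)   = Wit φ × Wit ψ
  Wit (φ ⅋ᶠ ψ)   = (CoWit ψ → Wit φ) × (CoWit φ → Wit ψ)
  Wit (!ᶠ φ)     = Wit φ
  Wit (?ᶠ φ)     = CoWit φ → List (Wit φ)
  CoWit (atom p) = ⊤
  CoWit (φ ᗮᶠ)   = Wit φ
  CoWit (φ ⊗ᶠ ψ) = (Wit ψ → CoWit φ) × (Wit φ → CoWit ψ)
  CoWit (φ ⅋ᶠ ψ) = CoWit φ × CoWit ψ
  CoWit (!ᶠ φ)   = Wit φ → List (CoWit φ)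
  CoWit (?ᶠ φ)   = CoWit φ

  ∣_∣ : (φ : Formula Atom) → Wit φ → CoWit φ → Ob
  ∣ atom p ∣ tt tt              = v p
  ∣ φ ᗮᶠ ∣ y x                  = (∣ φ ∣ x y) ᗮ
  ∣ φ ⊗ᶠ ψ ∣ (x , u) (f , g)    = ∣ φ ∣ x (f u) ⊗ ∣ ψ ∣ u (g x)
  ∣ φ ⅋ᶠ ψ ∣ (f , g) (y , w)    = ∣ φ ∣ (f w) y ⅋ ∣ ψ ∣ (g y) w
  ∣ !ᶠ φ ∣ x f                  = ⨂ (map (λ y → !₀ (∣ φ ∣ x y)) (f x))
  ∣ ?ᶠ φ ∣ g y                  = ⅋⨂ (map (λ x → ?₀ (∣ φ ∣ x y)) (g y))

module Submission where

-- By mutual induction on φ, ⟦φ⟧ maps into |φ|^x_y for one fixed witness x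
-- and every y, and receives a map from |φ|^x_y for one fixed counter-witness y
-- and every x; negation exchanges the two halves.  For ⊗ and ⅋ the missing
-- functional components are taken constant.  For ! the family
-- ⨂_{y ∈ f x} !|φ|^x_y is reached from !⟦φ⟧ by contraction, weakening and
-- functoriality of !, and dually for ?, where the witness can be chosen to be
-- a singleton multiset.

open import Defs
open import Level using (Level)
open import Data.Product using (Σ; _×_; _,_)
open import Data.List using (List; []; _∷_; map)
open import Data.Unit using (tt)

module Exponentials {o ℓ e : Level} (𝓡 : MELLModel o ℓ e) where
  open MELLModel 𝓡
  open Category R using (id; _∘_)
  open Category._≅_
  open SymmetricMonoidal monoidal using (_⊗₁_; unitorʳ)
  open StarAutonomous starAut using (neg₁; doubleNeg)
  open Cartesian cartesian using (⟨_,_⟩) renaming (! to terminal)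
  private
    module Lf = Functor L
    module Mf = Functor M
    module S = Category S

  infixr 10 _⅋₁_

  _⅋₁_ : ∀ {A B C D} → Hom A B → Hom C D → Hom (A ⅋ C) (B ⅋ D)
  f ⅋₁ g = neg₁ (neg₁ f ⊗₁ neg₁ g)

  ⅋-unitorʳ⁻¹ : ∀ {A} → Hom A (A ⅋ ⊥₀)
  ⅋-unitorʳ⁻¹ = neg₁ (from unitorʳ ∘ (id ⊗₁ to doubleNeg)) ∘ from doubleNeg

  !₁ : ∀ {A B} → Hom A B → Hom (!₀ A) (!₀ B)
  !₁ f = Lf.F₁ (Mf.F₁ f)

  ?₁ : ∀ {A B} → Hom A B → Hom (?₀ A) (?₀ B)
  ?₁ f = neg₁ (!₁ (neg₁ f))

  !-weaken : ∀ {A} → Hom (!₀ A) I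
  !-weaken = to L-unit ∘ Lf.F₁ terminal

  !-contract : ∀ {A} → Hom (!₀ A) (!₀ A ⊗ !₀ A)
  !-contract = to L-μ ∘ Lf.F₁ ⟨ S.id , S.id ⟩

  ?-weaken : ∀ {A} → Hom ⊥₀ (?₀ A)
  ?-weaken = neg₁ !-weaken

  ?-contract : ∀ {A} → Hom (?₀ A ⅋ ?₀ A) (?₀ A)
  ?-contract = neg₁ ((from doubleNeg ⊗₁ from doubleNeg) ∘ !-contract)

  !⇒⨂! : ∀ {A} {Y : Set} (B : Y → Ob) → ((y : Y) → Hom A (B y)) →
         (ys : List Y) → Hom (!₀ A) (⨂ (map (λ y → !₀ (B y)) ys))
  !⇒⨂! B f []       = !-weaken
  !⇒⨂! B f (y ∷ ys) = (!₁ (f y) ⊗₁ !⇒⨂! B f ys) ∘ !-contract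

  ⅋?⇒? : ∀ {A} {X : Set} (B : X → Ob) → ((x : X) → Hom (B x) A) →
         (xs : List X) → Hom (⅋⨂ (map (λ x → ?₀ (B x)) xs)) (?₀ A)
  ⅋?⇒? B f []       = ?-weaken
  ⅋?⇒? B f (x ∷ xs) = ?-contract ∘ (?₁ (f x) ⅋₁ ⅋?⇒? B f xs)

module UniformWitnesses {o ℓ e : Level} (𝓡 : MELLModel o ℓ e) {Atom : Set}
                        (v : Atom → MELLModel.Ob 𝓡) where
  open MELLModel 𝓡
  open Interpretation 𝓡 v
  open Exponentials 𝓡
  open Category R using (id; _∘_)
  open Category._≅_
  open SymmetricMonoidal monoidal using (_⊗₁_; unitorʳ)
  open StarAutonomous starAut using (neg₁)

  UniformWitness : Formula Atom → Set ℓ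
  UniformWitness φ = Σ (Wit φ) (λ x → (y : CoWit φ) → Hom ⟦ φ ⟧ (∣ φ ∣ x y))

  UniformCoWitness : Formula Atom → Set ℓ
  UniformCoWitness φ = Σ (CoWit φ) (λ y → (x : Wit φ) → Hom (∣ φ ∣ x y) ⟦ φ ⟧)

  uniformWitness   : (φ : Formula Atom) → UniformWitness φ
  uniformCoWitness : (φ : Formula Atom) → UniformCoWitness φ

  uniformWitness (atom p) = tt , λ _ → id
  uniformWitness (φ ᗮᶠ) with uniformCoWitness φ
  ... | y , f = y , λ x → neg₁ (f x)
  uniformWitness (φ ⊗ᶠ ψ) with uniformWitness φ | uniformWitness ψ
  ... | x , f | u , g = (x , u) , λ _ → f _ ⊗₁ g _
  uniformWitness (φ ⅋ᶠ ψ) with uniformWitness φ | uniformWitness ψ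
  ... | x , f | u , g = ((λ _ → x) , (λ _ → u)) , λ (y , w) → f y ⅋₁ g w
  uniformWitness (!ᶠ φ) with uniformWitness φ
  ... | x , f = x , λ h → !⇒⨂! (∣ φ ∣ x) f (h x)
  uniformWitness (?ᶠ φ) with uniformWitness φ
  ... | x , f = (λ _ → x ∷ []) , λ y → ⅋-unitorʳ⁻¹ ∘ ?₁ (f y)

  uniformCoWitness (atom p) = tt , λ _ → id
  uniformCoWitness (φ ᗮᶠ) with uniformWitness φ
  ... | x , f = x , λ y → neg₁ (f y)
  uniformCoWitness (φ ⊗ᶠ ψ) with uniformCoWitness φ | uniformCoWitness ψ
  ... | y , f | w , g = ((λ _ → y) , (λ _ → w)) , λ (x , u) → f x ⊗₁ g u
  uniformCoWitness (φ ⅋ᶠ ψ) with uniformCoWitness φ | uniformCoWitness ψ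
  ... | y , f | w , g = (y , w) , λ _ → f _ ⅋₁ g _
  uniformCoWitness (!ᶠ φ) with uniformCoWitness φ
  ... | y , f = (λ _ → y ∷ []) , λ x → !₁ (f x) ∘ from unitorʳ
  uniformCoWitness (?ᶠ φ) with uniformCoWitness φ
  ... | y , f = y , λ h → ⅋?⇒? (λ x → ∣ φ ∣ x y) f (h y)

mainTheorem4 : {o ℓ e : Level} (𝓡 : MELLModel o ℓ e) {Atom : Set}
               (v : Atom → MELLModel.Ob 𝓡) (φ : Formula Atom) →
               let open MELLModel 𝓡 using (Hom)
                   open Interpretation 𝓡 v
               in Σ (Wit φ) (λ x → (y : CoWit φ) → Hom ⟦ φ ⟧ (∣ φ ∣ x y))
                  × Σ (CoWit φ) (λ y → (x : Wit φ) → Hom (∣ φ ∣ x y) ⟦ φ ⟧)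
mainTheorem4 𝓡 v φ = uniformWitness φ , uniformCoWitness φ
  where open UniformWitnesses 𝓡 v
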